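{- There exists an algorithm that computes, for a given $\sharp\mathsf{EP}$-formula $\phi$, a logically equivalent flat $\sharp\mathsf{PP}$-formula $\phi'$ such that $\mathsf{width}(\phi')\le\mathsf{width}(\phi)$.
   Context: Structures are finite relational structures (no equality). pp-formulas are built from atoms with $\wedge,\exists$; ep-formulas additionally with $\vee$. $\sharp$-formulas: inductively, with free and closed variable sets: $C(\phi,L)$ ($\phi$ first-order, $L\supseteq\mathrm{free}(\phi)$; free $L$, closed $\emptyset$); $PV\psi$ ($V\cap\mathrm{closed}(\psi)=\emptyset$; free $\mathrm{free}(\psi)\setminus V$, closed $V\cup\mathrm{closed}(\psi)$); $EV\psi$ ($V$ disjoint from free and closed variables of $\psi$; free $V\cup\mathrm{free}(\psi)$, closed $\mathrm{closed}(\psi)$); $\psi\times\psi'$ (equal free sets, disjoint closed sets; free $\mathrm{free}(\psi)$, closed the union); $\psi+\psi'$ (equal free sets; closed the union); $n\in\mathbb{Z}$ (no free/closed variables). Semantics for $h:\mathrm{free}\to B$: $[\mathbf{B},C(\phi,L)](h)=1$ if $\mathbf{B},h\models\phi$, else $0$; $[\mathbf{B},PV\psi](h)=\sum[\mathbf{B},\psi](h')$ over extensions $h'$ of $h$ to $\mathrm{free}(\psi)\cup V$; $[\mathbf{B},EV\psi](h)=[\mathbf{B},\psi](h|_{\mathrm{free}(\psi)})$; $\times,+$ pointwise; $[\mathbf{B},n](h)=n$. Two $\sharp$-formulas with the same free variables are logically equivalent if $[\mathbf{B},\psi]=[\mathbf{B},\psi']$ for every structure $\mathbf{B}$. $\mathsf{width}$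 = max of $|\mathrm{free}(\theta)|$ over $\sharp$-subformulas $\theta$ (subtrees) and fo-subformulas $\theta$ (subformulas of $\phi$ occurring as $C(\phi,L)$). $\sharp\mathsf{PP}$ ($\sharp\mathsf{EP}$): every $C(\phi,L)$ has $\phi$ a pp- (ep-)formula. A $\sharp\mathsf{PP}$-formula is basic if it contains no $+$ and no subformula $n\in\mathbb{Z}$; constant if it is built only from integer constants, $\times$, and $P$- and $E$-quantifiers; flat if it is of the form $\sum_{i\in[\ell]}\psi_i\times\phi_i$ with each $\psi_i$ constant and each $\phi_i$ basic. -}

module Defs where

open import Data.Nat using (ℕ; zero; suc; _≡ᵇ_; _⊔_; _≟_)
open import Data.Bool using (Bool; true; false; if_then_else_; _∧_; _∨_; not)
open import Data.Fin using (Fin)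
open import Data.Vec using (Vec; lookup; toList)
open import Data.List using (List; []; _∷_; _++_; length; deduplicate; allFin; foldr; map)
open import Data.Bool.ListAction using (any; all)
open import Data.List.Membership.Propositional using (_∈_)
open import Data.Integer using (ℤ; 0ℤ; 1ℤ) renaming (_+_ to _+ℤ_; _*_ to _*ℤ_)
open import Data.Product using (_×_)
open import Data.Empty using (⊥)

record Signature : Set₁ where
  field
    Sym   : Set
    arity : Sym → ℕ
open Signature public

record Structure (σ : Signature) : Set where
  field
    size : ℕ
    rel  : (R : Sym σ) → (Fin (arity σ R) → Fin (suc size)) → Bool
open Structure public

Univ : ∀ {σ} → Structure σ → Set
Univ B = Fin (suc (size B))

-- Variables are natural numbers; assignments are total maps
-- (only the values on the free variables matter).
Var : Set
Var = ℕ

Assign : ∀ {σ} → Structure σ → Set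
Assign B = Var → Univ B

_[_↦_] : {A : Set} → (Var → A) → Var → A → (Var → A)
(g [ x ↦ b ]) y = if y ≡ᵇ x then b else g y

-- finite variable sets are represented by lists (order / repetitions irrelevant)
_∈ᵇ_ : Var → List Var → Bool
x ∈ᵇ V = any (x ≡ᵇ_) V

removeAll : List Var → List Var → List Var
removeAll V [] = []
removeAll V (x ∷ xs) = if x ∈ᵇ V then removeAll V xs else x ∷ removeAll V xs

card : List Var → ℕ
card xs = length (deduplicate _≟_ xs)

_⊆ˢ_ : List Var → List Var → Set
xs ⊆ˢ ys = ∀ {x} → x ∈ xs → x ∈ ys

_≈ˢ_ : List Var → List Var → Set
xs ≈ˢ ys = (xs ⊆ˢ ys) × (ys ⊆ˢ xs)

Disjoint : List Var → List Var → Set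
Disjoint xs ys = ∀ {x} → x ∈ xs → x ∈ ys → ⊥

data FO (σ : Signature) : Set where
  atom : (R : Sym σ) → Vec Var (arity σ R) → FO σ
  ⊤f   : FO σ
  ⊥f   : FO σ
  ¬f   : FO σ → FO σ
  _∧f_ : FO σ → FO σ → FO σ
  _∨f_ : FO σ → FO σ → FO σ
  ∃f   : Var → FO σ → FO σ
  ∀f   : Var → FO σ → FO σ

module _ {σ : Signature} where

  freeFO : FO σ → List Var
  freeFO (atom R xs) = toList xs
  freeFO ⊤f = []
  freeFO ⊥f = []
  freeFO (¬f φ) = freeFO φ
  freeFO (φ ∧f ψ) = freeFO φ ++ freeFO ψ
  freeFO (φ ∨f ψ) = freeFO φ ++ freeFO ψ
  freeFO (∃f x φ) = removeAll (x ∷ []) (freeFO φ)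
  freeFO (∀f x φ) = removeAll (x ∷ []) (freeFO φ)

  evalFO : (B : Structure σ) → FO σ → Assign B → Bool
  evalFO B (atom R xs) g = rel B R (λ i → g (lookup xs i))
  evalFO B ⊤f g = true
  evalFO B ⊥f g = false
  evalFO B (¬f φ) g = not (evalFO B φ g)
  evalFO B (φ ∧f ψ) g = evalFO B φ g ∧ evalFO B ψ g
  evalFO B (φ ∨f ψ) g = evalFO B φ g ∨ evalFO B ψ g
  evalFO B (∃f x φ) g = any (λ b → evalFO B φ (g [ x ↦ b ])) (allFin (suc (size B)))
  evalFO B (∀f x φ) g = all (λ b → evalFO B φ (g [ x ↦ b ])) (allFin (suc (size B)))

  data IsPP : FO σ → Set where
    atom : ∀ R xs → IsPP (atom R xs)
    ⊤f   : IsPP ⊤f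
    _∧f_ : ∀ {φ ψ} → IsPP φ → IsPP ψ → IsPP (φ ∧f ψ)
    ∃f   : ∀ x {φ} → IsPP φ → IsPP (∃f x φ)

  data IsEP : FO σ → Set where
    atom : ∀ R xs → IsEP (atom R xs)
    ⊤f   : IsEP ⊤f
    _∧f_ : ∀ {φ ψ} → IsEP φ → IsEP ψ → IsEP (φ ∧f ψ)
    _∨f_ : ∀ {φ ψ} → IsEP φ → IsEP ψ → IsEP (φ ∨f ψ)
    ∃f   : ∀ x {φ} → IsEP φ → IsEP (∃f x φ)

  widthFO : FO σ → ℕ
  widthFO φ@(atom R xs) = card (freeFO φ)
  widthFO ⊤f = 0
  widthFO ⊥f = 0
  widthFO φ@(¬f ψ) = card (freeFO φ) ⊔ widthFO ψ
  widthFO φ@(ψ ∧f χ) = card (freeFO φ) ⊔ widthFO ψ ⊔ widthFO χ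
  widthFO φ@(ψ ∨f χ) = card (freeFO φ) ⊔ widthFO ψ ⊔ widthFO χ
  widthFO φ@(∃f x ψ) = card (freeFO φ) ⊔ widthFO ψ
  widthFO φ@(∀f x ψ) = card (freeFO φ) ⊔ widthFO ψ

data SF (σ : Signature) : Set where
  C     : FO σ → List Var → SF σ
  P     : List Var → SF σ → SF σ
  E     : List Var → SF σ → SF σ
  _⊗_   : SF σ → SF σ → SF σ
  _⊕_   : SF σ → SF σ → SF σ
  const : ℤ → SF σ

module _ {σ : Signature} where

  free : SF σ → List Var
  free (C φ L) = L
  free (P V ψ) = removeAll V (free ψ)
  free (E V ψ) = V ++ free ψ
  free (ψ ⊗ χ) = free ψ
  free (ψ ⊕ χ) = free ψ
  free (const n) = []

  closed : SF σ → List Var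
  closed (C φ L) = []
  closed (P V ψ) = V ++ closed ψ
  closed (E V ψ) = closed ψ
  closed (ψ ⊗ χ) = closed ψ ++ closed χ
  closed (ψ ⊕ χ) = closed ψ ++ closed χ
  closed (const n) = []

  -- the side conditions of the inductive definition of ♯-formulas
  data WF : SF σ → Set where
    C   : ∀ φ L → freeFO φ ⊆ˢ L → WF (C φ L)
    P   : ∀ V {ψ} → WF ψ → Disjoint V (closed ψ) → WF (P V ψ)
    E   : ∀ V {ψ} → WF ψ → Disjoint V (free ψ) → Disjoint V (closed ψ) → WF (E V ψ)
    _⊗_ : ∀ {ψ χ} → WF ψ → WF χ → free ψ ≈ˢ free χ → Disjoint (closed ψ) (closed χ) → WF (ψ ⊗ χ)
    _⊕_ : ∀ {ψ χ} → WF ψ → WF χ → free ψ ≈ˢ free χ → WF (ψ ⊕ χ)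
    const : ∀ n → WF (const n)

  -- sum of f over all ways of re-assigning the variables in V (V a duplicate-free list)
  sumOver : (B : Structure σ) → List Var → Assign B → (Assign B → ℤ) → ℤ
  sumOver B [] g f = f g
  sumOver B (x ∷ V) g f =
    foldr _+ℤ_ 0ℤ (map (λ b → sumOver B V (g [ x ↦ b ]) f) (allFin (suc (size B))))

  -- [B, ψ](h), evaluated at a total assignment extending h
  ⟦_⟧ : SF σ → (B : Structure σ) → Assign B → ℤ
  ⟦ C φ L ⟧ B g = if evalFO B φ g then 1ℤ else 0ℤ
  ⟦ P V ψ ⟧ B g = sumOver B (deduplicate _≟_ V) g (⟦ ψ ⟧ B)
  ⟦ E V ψ ⟧ B g = ⟦ ψ ⟧ B g
  ⟦ ψ ⊗ χ ⟧ B g = ⟦ ψ ⟧ B g *ℤ ⟦ χ ⟧ B g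
  ⟦ ψ ⊕ χ ⟧ B g = ⟦ ψ ⟧ B g +ℤ ⟦ χ ⟧ B g
  ⟦ const n ⟧ B g = n

  LogEquiv : SF σ → SF σ → Set
  LogEquiv ψ χ = (free ψ ≈ˢ free χ) × (∀ (B : Structure σ) (g : Assign B) → ⟦ ψ ⟧ B g ≡ ⟦ χ ⟧ B g)
    where open import Relation.Binary.PropositionalEquality using (_≡_)

  width : SF σ → ℕ
  width θ@(C φ L) = card (free θ) ⊔ widthFO φ
  width θ@(P V ψ) = card (free θ) ⊔ width ψ
  width θ@(E V ψ) = card (free θ) ⊔ width ψ
  width θ@(ψ ⊗ χ) = card (free θ) ⊔ width ψ ⊔ width χ
  width θ@(ψ ⊕ χ) = card (free θ) ⊔ width ψ ⊔ width χ
  width θ@(const n) = card (free θ)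

  data AllC (Q : FO σ → Set) : SF σ → Set where
    C     : ∀ {φ} L → Q φ → AllC Q (C φ L)
    P     : ∀ V {ψ} → AllC Q ψ → AllC Q (P V ψ)
    E     : ∀ V {ψ} → AllC Q ψ → AllC Q (E V ψ)
    _⊗_   : ∀ {ψ χ} → AllC Q ψ → AllC Q χ → AllC Q (ψ ⊗ χ)
    _⊕_   : ∀ {ψ χ} → AllC Q ψ → AllC Q χ → AllC Q (ψ ⊕ χ)
    const : ∀ n → AllC Q (const n)

  SharpPP : SF σ → Set
  SharpPP = AllC IsPP

  SharpEP : SF σ → Set
  SharpEP = AllC IsEP

  data Basic : SF σ → Set where
    C   : ∀ {φ} L → IsPP φ → Basic (C φ L)
    P   : ∀ V {ψ} → Basic ψ → Basic (P V ψ)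
    E   : ∀ V {ψ} → Basic ψ → Basic (E V ψ)
    _⊗_ : ∀ {ψ χ} → Basic ψ → Basic χ → Basic (ψ ⊗ χ)

  data Constant : SF σ → Set where
    const : ∀ n → Constant (const n)
    P     : ∀ V {ψ} → Constant ψ → Constant (P V ψ)
    E     : ∀ V {ψ} → Constant ψ → Constant (E V ψ)
    _⊗_   : ∀ {ψ χ} → Constant ψ → Constant χ → Constant (ψ ⊗ χ)

  data Flat : SF σ → Set where
    term : ∀ {ψ φ} → Constant ψ → Basic φ → Flat (ψ ⊗ φ)
    _⊕_  : ∀ {ψ χ} → Flat ψ → Flat χ → Flat (ψ ⊕ χ)

-- An ep-formula is equivalent to the disjunction of its disjunctive normal form, whose disjuncts are
-- pp-formulas with no new free variables and no larger width. By inclusion–exclusion the indicator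
-- of a disjunction is a ℤ-linear combination of indicators of conjunctions of disjuncts, which are
-- again such pp-formulas; so C(φ, L) is a linear combination of basic formulas C(π, L). Linear
-- combinations of basic formulas are preserved by P (summation is linear), E, × (by distributivity)
-- and +, and each summand keeps the free variables, closed variables and width of the subformula it
-- comes from. Writing every coefficient n as the constant E F n yields the flat formula.

module Submission where

open import Defs
open import Algebra.Bundles using (CommutativeMonoid)
open import Data.Bool using (Bool; true; false; if_then_else_; _∧_; _∨_)
open import Data.Bool.ListAction using (any; or)
open import Data.Bool.Properties using (∨-identityʳ; ∨-assoc; ∧-distribʳ-∨; ∨-commutativeMonoid)
open import Data.Empty using (⊥-elim)
open import Data.Integer using (ℤ; 0ℤ; 1ℤ; -1ℤ) renaming (_+_ to _+ℤ_; _*_ to _*ℤ_)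
open import Data.Integer.Properties
  using (+-identityˡ; +-identityʳ; +-assoc; *-identityˡ; *-identityʳ; *-zeroʳ; *-distribʳ-+)
open import Data.Integer.Tactic.RingSolver using (solve-∀)
open import Data.List using (List; []; _∷_; _++_; [_]; length; deduplicate; map; foldr; allFin; cartesianProductWith)
open import Data.List.Properties using (length-++-sucʳ; map-cong; map-∘)
open import Data.List.Membership.Propositional using (_∈_)
open import Data.List.Membership.Propositional.Properties using (∈-++⁻; ∈-∃++; ∈-deduplicate⁻; ∈-deduplicate⁺)
open import Data.List.Relation.Binary.Subset.Propositional using (_⊆_)
open import Data.List.Relation.Binary.Subset.Propositional.Properties
  using (⊆-refl; ⊆-trans; xs⊆xs++ys; xs⊆ys++xs; ++⁺; ++⁺ʳ)
open import Data.List.Relation.Unary.All as All using (All; []; _∷_)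
open import Data.List.Relation.Unary.All.Properties using (gmap⁺) renaming (++⁺ to All-++⁺)
open import Data.List.Relation.Unary.Any using (here; there)
open import Data.List.Relation.Unary.Unique.Propositional using (Unique; []; _∷_)
open import Data.Nat using (suc; _≤_; z≤n; s≤s; _≟_)
open import Data.Nat.Properties using (≤-refl; ≤-trans; ≤-reflexive; ⊔-lub; ⊔-mono-≤; ⊔-monoʳ-≤; m≤m⊔n; m≤n⊔m)
open import Data.Product using (Σ-syntax; _×_; _,_; proj₁; proj₂; map₁; map₂)
open import Data.Sum using (inj₁; inj₂; [_,_]′)
open import Function using (_∘_)
open import Relation.Binary.PropositionalEquality using (_≡_; refl; sym; trans; cong; cong₂; module ≡-Reasoning)

open import Data.List.Relation.Unary.Unique.DecPropositional.Properties _≟_ using (deduplicate-!)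
open import Algebra.Properties.CommutativeSemigroup
  (CommutativeMonoid.commutativeSemigroup ∨-commutativeMonoid) using () renaming (interchange to ∨-interchange)

private
  variable
    A B : Set
    xs ys zs : List Var

≈ˢ-refl : xs ≈ˢ xs
≈ˢ-refl = ⊆-refl , ⊆-refl

≈ˢ-sym : xs ≈ˢ ys → ys ≈ˢ xs
≈ˢ-sym (xs⊆ys , ys⊆xs) = ys⊆xs , xs⊆ys

≈ˢ-trans : xs ≈ˢ ys → ys ≈ˢ zs → xs ≈ˢ zs
≈ˢ-trans (xs⊆ys , ys⊆xs) (ys⊆zs , zs⊆ys) = ⊆-trans xs⊆ys ys⊆zs , ⊆-trans zs⊆ys ys⊆xs

++-⊆ : xs ⊆ zs → ys ⊆ zs → xs ++ ys ⊆ zs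
++-⊆ {xs} xs⊆zs ys⊆zs = [ xs⊆zs , ys⊆zs ]′ ∘ ∈-++⁻ xs

xs++[]≈ˢxs : ∀ xs → (xs ++ []) ≈ˢ xs
xs++[]≈ˢxs xs = ++-⊆ ⊆-refl (λ ()) , xs⊆xs++ys xs []

∈-removeAll⁻ : ∀ {V x} xs → x ∈ removeAll V xs → x ∈ xs × (x ∈ᵇ V) ≡ false
∈-removeAll⁻ {V} (y ∷ ys) x∈ with y ∈ᵇ V in y∈ᵇV
... | true = map₁ there (∈-removeAll⁻ ys x∈)
... | false with x∈
... | here refl = here refl , y∈ᵇV
... | there x∈′ = map₁ there (∈-removeAll⁻ ys x∈′)

∈-removeAll⁺ : ∀ {V x} xs → x ∈ xs → (x ∈ᵇ V) ≡ false → x ∈ removeAll V xs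
∈-removeAll⁺ {V} (y ∷ ys) (here refl) x∉V rewrite x∉V = here refl
∈-removeAll⁺ {V} (y ∷ ys) (there x∈) x∉V with y ∈ᵇ V
... | true = ∈-removeAll⁺ ys x∈ x∉V
... | false = there (∈-removeAll⁺ ys x∈ x∉V)

removeAll⁺ : ∀ V → xs ⊆ ys → removeAll V xs ⊆ removeAll V ys
removeAll⁺ {xs} {ys} V xs⊆ys x∈ =
  let x∈xs , x∉V = ∈-removeAll⁻ xs x∈ in ∈-removeAll⁺ ys (xs⊆ys x∈xs) x∉V

removeAll-≈ˢ : ∀ V → xs ≈ˢ ys → removeAll V xs ≈ˢ removeAll V ys
removeAll-≈ˢ V (xs⊆ys , ys⊆xs) = removeAll⁺ V xs⊆ys , removeAll⁺ V ys⊆xs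

length-mono-⊆-Unique : Unique xs → xs ⊆ ys → length xs ≤ length ys
length-mono-⊆-Unique {[]} _ _ = z≤n
length-mono-⊆-Unique {x ∷ xs} {ys} (x∉xs ∷ unique) x∷xs⊆ys with ∈-∃++ (x∷xs⊆ys (here refl))
... | us , vs , refl = ≤-trans (s≤s (length-mono-⊆-Unique unique xs⊆us++vs))
                               (≤-reflexive (sym (length-++-sucʳ us x vs)))
  where
  xs⊆us++vs : xs ⊆ us ++ vs
  xs⊆us++vs {y} y∈xs with ∈-++⁻ us (x∷xs⊆ys (there y∈xs))
  ... | inj₁ y∈us = xs⊆xs++ys us vs y∈us
  ... | inj₂ (here refl) = ⊥-elim (All.lookup x∉xs y∈xs refl)
  ... | inj₂ (there y∈vs) = xs⊆ys++xs vs us y∈vs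

card-mono : xs ⊆ ys → card xs ≤ card ys
card-mono {xs} xs⊆ys = length-mono-⊆-Unique (deduplicate-! xs)
  (∈-deduplicate⁺ _≟_ ∘ xs⊆ys ∘ ∈-deduplicate⁻ _≟_ xs)

any-++ : (p : A → Bool) (xs ys : List A) → any p (xs ++ ys) ≡ any p xs ∨ any p ys
any-++ p [] ys = refl
any-++ p (x ∷ xs) ys = trans (cong (p x ∨_) (any-++ p xs ys)) (sym (∨-assoc (p x) _ _))

any-cong : {p q : A → Bool} → (∀ a → p a ≡ q a) → (xs : List A) → any p xs ≡ any q xs
any-cong p≗q xs = cong or (map-cong p≗q xs)

any-map : (p : B → Bool) (f : A → B) (xs : List A) → any p (map f xs) ≡ any (p ∘ f) xs
any-map p f xs = cong or (sym (map-∘ xs))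

any-∨ : (p q : A → Bool) (xs : List A) → any (λ a → p a ∨ q a) xs ≡ any p xs ∨ any q xs
any-∨ p q [] = refl
any-∨ p q (x ∷ xs) =
  trans (cong ((p x ∨ q x) ∨_) (any-∨ p q xs)) (∨-interchange (p x) (q x) (any p xs) (any q xs))

any-false : (xs : List A) → any (λ _ → false) xs ≡ false
any-false [] = refl
any-false (x ∷ xs) = any-false xs

any-∧ˡ : (b : Bool) (p : A → Bool) (xs : List A) → any (λ a → b ∧ p a) xs ≡ b ∧ any p xs
any-∧ˡ true p xs = refl
any-∧ˡ false p xs = any-false xs

any-comm : (p : A → B → Bool) (xs : List A) (ys : List B) →
  any (λ y → any (λ x → p x y) xs) ys ≡ any (λ x → any (p x) ys) xs
any-comm p [] ys = any-false ys
any-comm p (x ∷ xs) ys =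
  trans (any-∨ (p x) (λ y → any (λ x → p x y) xs) ys) (cong (any (p x) ys ∨_) (any-comm p xs ys))

any-cartesianProductWith : (p : A → Bool) (_∙_ : A → A → A) → (∀ a b → p (a ∙ b) ≡ p a ∧ p b) →
  (xs ys : List A) → any p (cartesianProductWith _∙_ xs ys) ≡ any p xs ∧ any p ys
any-cartesianProductWith p _∙_ p-∙ [] ys = refl
any-cartesianProductWith p _∙_ p-∙ (x ∷ xs) ys = begin
  any p (map (x ∙_) ys ++ cartesianProductWith _∙_ xs ys)
    ≡⟨ any-++ p (map (x ∙_) ys) _ ⟩
  any p (map (x ∙_) ys) ∨ any p (cartesianProductWith _∙_ xs ys)
    ≡⟨ cong₂ _∨_ (trans (any-map p (x ∙_) ys) (any-cong (p-∙ x) ys))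
                 (any-cartesianProductWith p _∙_ p-∙ xs ys) ⟩
  any (λ y → p x ∧ p y) ys ∨ (any p xs ∧ any p ys)
    ≡⟨ cong (_∨ (any p xs ∧ any p ys)) (any-∧ˡ (p x) p ys) ⟩
  (p x ∧ any p ys) ∨ (any p xs ∧ any p ys)
    ≡⟨ ∧-distribʳ-∨ (any p ys) (p x) (any p xs) ⟨
  (p x ∨ any p xs) ∧ any p ys
    ∎
  where open ≡-Reasoning

All-cartesianProductWith : {C : Set} {Q₁ : A → Set} {Q₂ : B → Set} {Q₃ : C → Set} {f : A → B → C} →
  (∀ {a b} → Q₁ a → Q₂ b → Q₃ (f a b)) →
  ∀ {xs ys} → All Q₁ xs → All Q₂ ys → All Q₃ (cartesianProductWith f xs ys)
All-cartesianProductWith f-pres [] qs = []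
All-cartesianProductWith f-pres (p ∷ ps) qs =
  All-++⁺ (gmap⁺ (f-pres p) qs) (All-cartesianProductWith f-pres ps qs)

LinComb : Set → Set
LinComb A = List (ℤ × A)

evalLC : (A → ℤ) → LinComb A → ℤ
evalLC f [] = 0ℤ
evalLC f ((c , a) ∷ ts) = c *ℤ f a +ℤ evalLC f ts

mulTerm : (A → A → A) → ℤ × A → ℤ × A → ℤ × A
mulTerm _∙_ (c , a) (d , b) = c *ℤ d , a ∙ b

mulLC : (A → A → A) → LinComb A → LinComb A → LinComb A
mulLC _∙_ = cartesianProductWith (mulTerm _∙_)

evalLC-++ : (f : A → ℤ) (ts us : LinComb A) → evalLC f (ts ++ us) ≡ evalLC f ts +ℤ evalLC f us
evalLC-++ f [] us = sym (+-identityˡ _)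
evalLC-++ f ((c , a) ∷ ts) us =
  trans (cong (c *ℤ f a +ℤ_) (evalLC-++ f ts us)) (sym (+-assoc (c *ℤ f a) _ _))

evalLC-map₂ : (f : B → ℤ) (g : A → B) (ts : LinComb A) → evalLC f (map (map₂ g) ts) ≡ evalLC (f ∘ g) ts
evalLC-map₂ f g [] = refl
evalLC-map₂ f g ((c , a) ∷ ts) = cong (c *ℤ f (g a) +ℤ_) (evalLC-map₂ f g ts)

module _ (f : A → ℤ) (_∙_ : A → A → A) (f-∙ : ∀ a b → f (a ∙ b) ≡ f a *ℤ f b) where

  evalLC-map-mulTerm : ∀ c a (us : LinComb A) →
    evalLC f (map (mulTerm _∙_ (c , a)) us) ≡ (c *ℤ f a) *ℤ evalLC f us
  evalLC-map-mulTerm c a [] = sym (*-zeroʳ (c *ℤ f a))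
  evalLC-map-mulTerm c a ((d , b) ∷ us)
    rewrite f-∙ a b | evalLC-map-mulTerm c a us = distribute c d (f a) (f b) (evalLC f us)
    where
    distribute : ∀ c d x y e → c *ℤ d *ℤ (x *ℤ y) +ℤ c *ℤ x *ℤ e ≡ c *ℤ x *ℤ (d *ℤ y +ℤ e)
    distribute = solve-∀

  evalLC-mulLC : (ts us : LinComb A) → evalLC f (mulLC _∙_ ts us) ≡ evalLC f ts *ℤ evalLC f us
  evalLC-mulLC [] us = refl
  evalLC-mulLC ((c , a) ∷ ts) us = begin
    evalLC f (map (mulTerm _∙_ (c , a)) us ++ mulLC _∙_ ts us)
      ≡⟨ evalLC-++ f (map (mulTerm _∙_ (c , a)) us) _ ⟩
    evalLC f (map (mulTerm _∙_ (c , a)) us) +ℤ evalLC f (mulLC _∙_ ts us)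
      ≡⟨ cong₂ _+ℤ_ (evalLC-map-mulTerm c a us) (evalLC-mulLC ts us) ⟩
    c *ℤ f a *ℤ evalLC f us +ℤ evalLC f ts *ℤ evalLC f us
      ≡⟨ *-distribʳ-+ (evalLC f us) (c *ℤ f a) (evalLC f ts) ⟨
    (c *ℤ f a +ℤ evalLC f ts) *ℤ evalLC f us
      ∎
    where open ≡-Reasoning

ind : Bool → ℤ
ind b = if b then 1ℤ else 0ℤ

ind-∧ : ∀ a b → ind (a ∧ b) ≡ ind a *ℤ ind b
ind-∧ true b = sym (*-identityˡ (ind b))
ind-∧ false b = refl

ind-∨ : ∀ a b → ind (a ∨ b) ≡ ind a +ℤ ind b +ℤ -1ℤ *ℤ ind a *ℤ ind b
ind-∨ true true = refl
ind-∨ true false = refl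
ind-∨ false true = refl
ind-∨ false false = refl

-- 1_{a ∨ S} = 1_a + 1_S − 1_{a ∧ S}, unfolded recursively over the list.
inclusionExclusion : (A → A → A) → List A → LinComb A
inclusionExclusion _∙_ [] = []
inclusionExclusion _∙_ (a ∷ as) =
  (1ℤ , a) ∷ (inclusionExclusion _∙_ as ++ mulLC _∙_ [ -1ℤ , a ] (inclusionExclusion _∙_ as))

module _ (p : A → Bool) (_∙_ : A → A → A) (p-∙ : ∀ a b → p (a ∙ b) ≡ p a ∧ p b) where

  evalLC-inclusionExclusion : (as : List A) → evalLC (ind ∘ p) (inclusionExclusion _∙_ as) ≡ ind (any p as)
  evalLC-inclusionExclusion [] = refl
  evalLC-inclusionExclusion (a ∷ as) = begin
    1ℤ *ℤ ind (p a) +ℤ evalLC (ind ∘ p) (IE ++ mulLC _∙_ [ -1ℤ , a ] IE)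
      ≡⟨ cong (1ℤ *ℤ ind (p a) +ℤ_) (evalLC-++ (ind ∘ p) IE _) ⟩
    1ℤ *ℤ ind (p a) +ℤ (evalLC (ind ∘ p) IE +ℤ evalLC (ind ∘ p) (mulLC _∙_ [ -1ℤ , a ] IE))
      ≡⟨ cong (λ e → 1ℤ *ℤ ind (p a) +ℤ (evalLC (ind ∘ p) IE +ℤ e))
              (evalLC-mulLC (ind ∘ p) _∙_ ind-p-∙ [ -1ℤ , a ] IE) ⟩
    1ℤ *ℤ ind (p a) +ℤ (evalLC (ind ∘ p) IE +ℤ (-1ℤ *ℤ ind (p a) +ℤ 0ℤ) *ℤ evalLC (ind ∘ p) IE)
      ≡⟨ cong (λ e → 1ℤ *ℤ ind (p a) +ℤ (e +ℤ (-1ℤ *ℤ ind (p a) +ℤ 0ℤ) *ℤ e))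
              (evalLC-inclusionExclusion as) ⟩
    1ℤ *ℤ ind (p a) +ℤ (ind (any p as) +ℤ (-1ℤ *ℤ ind (p a) +ℤ 0ℤ) *ℤ ind (any p as))
      ≡⟨ normalise (ind (p a)) (ind (any p as)) ⟩
    ind (p a) +ℤ ind (any p as) +ℤ -1ℤ *ℤ ind (p a) *ℤ ind (any p as)
      ≡⟨ ind-∨ (p a) (any p as) ⟨
    ind (p a ∨ any p as)
      ∎
    where
    open ≡-Reasoning
    IE = inclusionExclusion _∙_ as
    ind-p-∙ : ∀ a b → ind (p (a ∙ b)) ≡ ind (p a) *ℤ ind (p b)
    ind-p-∙ a b = trans (cong ind (p-∙ a b)) (ind-∧ (p a) (p b))
    normalise : ∀ x y → 1ℤ *ℤ x +ℤ (y +ℤ (-1ℤ *ℤ x +ℤ 0ℤ) *ℤ y) ≡ x +ℤ y +ℤ -1ℤ *ℤ x *ℤ y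
    normalise = solve-∀

All-mulLC : {Q₁ Q₂ Q₃ : A → Set} {_∙_ : A → A → A} → (∀ {a b} → Q₁ a → Q₂ b → Q₃ (a ∙ b)) →
  ∀ {ts us} → All (Q₁ ∘ proj₂) ts → All (Q₂ ∘ proj₂) us → All (Q₃ ∘ proj₂) (mulLC _∙_ ts us)
All-mulLC {Q₁ = Q₁} {Q₂} {Q₃} {_∙_} ∙-pres =
  All-cartesianProductWith {Q₁ = Q₁ ∘ proj₂} {Q₂ ∘ proj₂} {Q₃ ∘ proj₂} {mulTerm _∙_} ∙-pres

All-inclusionExclusion : {Q : A → Set} {_∙_ : A → A → A} → (∀ {a b} → Q a → Q b → Q (a ∙ b)) →
  ∀ {as} → All Q as → All (Q ∘ proj₂) (inclusionExclusion _∙_ as)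
All-inclusionExclusion ∙-closed [] = []
All-inclusionExclusion {Q = Q} ∙-closed {a ∷ as} (q ∷ qs) =
  q ∷ All-++⁺ rest (All-mulLC {Q₁ = Q} {Q} {Q} ∙-closed {ts = [ -1ℤ , a ]} (q ∷ []) rest)
  where rest = All-inclusionExclusion ∙-closed qs

sumMap : (A → ℤ) → List A → ℤ
sumMap f xs = foldr _+ℤ_ 0ℤ (map f xs)

sumMap-linear : (c : ℤ) (f g : A → ℤ) (xs : List A) →
  sumMap (λ a → c *ℤ f a +ℤ g a) xs ≡ c *ℤ sumMap f xs +ℤ sumMap g xs
sumMap-linear c f g [] = sym (cong (_+ℤ 0ℤ) (*-zeroʳ c))
sumMap-linear c f g (x ∷ xs) rewrite sumMap-linear c f g xs =
  regroup c (f x) (g x) (sumMap f xs) (sumMap g xs)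
  where
  regroup : ∀ c a b d e → c *ℤ a +ℤ b +ℤ (c *ℤ d +ℤ e) ≡ c *ℤ (a +ℤ d) +ℤ (b +ℤ e)
  regroup = solve-∀

sumMap-zero : (xs : List A) → sumMap (λ _ → 0ℤ) xs ≡ 0ℤ
sumMap-zero [] = refl
sumMap-zero (x ∷ xs) = trans (+-identityˡ _) (sumMap-zero xs)

module _ {σ : Signature} (𝔹 : Structure σ) where

  private
    universe : List (Univ 𝔹)
    universe = allFin (suc (size 𝔹))

  sumOver-cong : ∀ W g {f f′ : Assign 𝔹 → ℤ} → (∀ h → f h ≡ f′ h) → sumOver 𝔹 W g f ≡ sumOver 𝔹 W g f′
  sumOver-cong [] g f≗f′ = f≗f′ g
  sumOver-cong (x ∷ W) g f≗f′ =
    cong (foldr _+ℤ_ 0ℤ) (map-cong (λ b → sumOver-cong W (g [ x ↦ b ]) f≗f′) universe)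

  sumOver-linear : ∀ W g (c : ℤ) (f f′ : Assign 𝔹 → ℤ) →
    sumOver 𝔹 W g (λ h → c *ℤ f h +ℤ f′ h) ≡ c *ℤ sumOver 𝔹 W g f +ℤ sumOver 𝔹 W g f′
  sumOver-linear [] g c f f′ = refl
  sumOver-linear (x ∷ W) g c f f′ =
    trans (cong (foldr _+ℤ_ 0ℤ) (map-cong (λ b → sumOver-linear W (g [ x ↦ b ]) c f f′) universe))
          (sumMap-linear c (λ b → sumOver 𝔹 W (g [ x ↦ b ]) f) (λ b → sumOver 𝔹 W (g [ x ↦ b ]) f′)
                         universe)

  sumOver-zero : ∀ W g → sumOver 𝔹 W g (λ _ → 0ℤ) ≡ 0ℤ
  sumOver-zero [] g = refl
  sumOver-zero (x ∷ W) g =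
    trans (cong (foldr _+ℤ_ 0ℤ) (map-cong (λ b → sumOver-zero W (g [ x ↦ b ])) universe))
          (sumMap-zero universe)

  sumOver-evalLC : ∀ W g (F : A → Assign 𝔹 → ℤ) (ts : LinComb A) →
    sumOver 𝔹 W g (λ h → evalLC (λ a → F a h) ts) ≡ evalLC (λ a → sumOver 𝔹 W g (F a)) ts
  sumOver-evalLC W g F [] = sumOver-zero W g
  sumOver-evalLC W g F ((c , a) ∷ ts) =
    trans (sumOver-linear W g c (F a) (λ h → evalLC (λ a → F a h) ts))
          (cong (c *ℤ sumOver 𝔹 W g (F a) +ℤ_) (sumOver-evalLC W g F ts))

module _ {σ : Signature} where

  dnf : FO σ → List (FO σ)
  dnf (φ ∧f ψ) = cartesianProductWith _∧f_ (dnf φ) (dnf ψ)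
  dnf (φ ∨f ψ) = dnf φ ++ dnf ψ
  dnf (∃f x φ) = map (∃f x) (dnf φ)
  dnf φ = [ φ ]

  evalFO-dnf : ∀ {φ} → IsEP φ → (𝔹 : Structure σ) (g : Assign 𝔹) →
    evalFO 𝔹 φ g ≡ any (λ π → evalFO 𝔹 π g) (dnf φ)
  evalFO-dnf (atom R xs) 𝔹 g = sym (∨-identityʳ _)
  evalFO-dnf ⊤f 𝔹 g = refl
  evalFO-dnf (_∧f_ {φ} {ψ} φ-ep ψ-ep) 𝔹 g =
    trans (cong₂ _∧_ (evalFO-dnf φ-ep 𝔹 g) (evalFO-dnf ψ-ep 𝔹 g))
          (sym (any-cartesianProductWith (λ π → evalFO 𝔹 π g) _∧f_ (λ _ _ → refl) (dnf φ) (dnf ψ)))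
  evalFO-dnf (_∨f_ {φ} {ψ} φ-ep ψ-ep) 𝔹 g =
    trans (cong₂ _∨_ (evalFO-dnf φ-ep 𝔹 g) (evalFO-dnf ψ-ep 𝔹 g))
          (sym (any-++ (λ π → evalFO 𝔹 π g) (dnf φ) (dnf ψ)))
  evalFO-dnf (∃f x {φ} φ-ep) 𝔹 g = begin
    any (λ b → evalFO 𝔹 φ (g [ x ↦ b ])) (allFin (suc (size 𝔹)))
      ≡⟨ any-cong (λ b → evalFO-dnf φ-ep 𝔹 (g [ x ↦ b ])) (allFin (suc (size 𝔹))) ⟩
    any (λ b → any (λ π → evalFO 𝔹 π (g [ x ↦ b ])) (dnf φ)) (allFin (suc (size 𝔹)))
      ≡⟨ any-comm (λ π b → evalFO 𝔹 π (g [ x ↦ b ])) (dnf φ) (allFin (suc (size 𝔹))) ⟩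
    any (λ π → evalFO 𝔹 (∃f x π) g) (dnf φ)
      ≡⟨ any-map (λ π → evalFO 𝔹 π g) (∃f x) (dnf φ) ⟨
    any (λ π → evalFO 𝔹 π g) (map (∃f x) (dnf φ))
      ∎
    where open ≡-Reasoning

  widthFO-free : (φ : FO σ) → card (freeFO φ) ≤ widthFO φ
  widthFO-free (atom R xs) = ≤-refl
  widthFO-free ⊤f = z≤n
  widthFO-free ⊥f = z≤n
  widthFO-free (¬f φ) = m≤m⊔n _ _
  widthFO-free (φ ∧f ψ) = ≤-trans (m≤m⊔n _ (widthFO φ)) (m≤m⊔n _ (widthFO ψ))
  widthFO-free (φ ∨f ψ) = ≤-trans (m≤m⊔n _ (widthFO φ)) (m≤m⊔n _ (widthFO ψ))
  widthFO-free (∃f x φ) = m≤m⊔n _ _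
  widthFO-free (∀f x φ) = m≤m⊔n _ _

  record PPWithin (φ π : FO σ) : Set where
    constructor ppWithin
    field
      pp     : IsPP π
      free⊆  : freeFO π ⊆ freeFO φ
      width≤ : widthFO π ≤ widthFO φ

  PPWithin-∧ : ∀ {φ π π′} → PPWithin φ π → PPWithin φ π′ → PPWithin φ (π ∧f π′)
  PPWithin-∧ {φ} (ppWithin pp free⊆ width≤) (ppWithin pp′ free⊆′ width≤′) =
    ppWithin (pp ∧f pp′) (++-⊆ free⊆ free⊆′)
      (⊔-lub (⊔-lub (≤-trans (card-mono (++-⊆ free⊆ free⊆′)) (widthFO-free φ)) width≤) width≤′)

  PPWithin-weaken : ∀ {φ ψ π} → freeFO φ ⊆ freeFO ψ → widthFO φ ≤ widthFO ψ → PPWithin φ π → PPWithin ψ π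
  PPWithin-weaken φ⊆ψ φ≤ψ (ppWithin pp free⊆ width≤) = ppWithin pp (⊆-trans free⊆ φ⊆ψ) (≤-trans width≤ φ≤ψ)

  PPWithin-∃ : ∀ {φ π} x → PPWithin φ π → PPWithin (∃f x φ) (∃f x π)
  PPWithin-∃ x (ppWithin pp free⊆ width≤) =
    ppWithin (∃f x pp) (removeAll⁺ [ x ] free⊆) (⊔-mono-≤ (card-mono (removeAll⁺ [ x ] free⊆)) width≤)

  dnf-PPWithin : ∀ {φ} → IsEP φ → All (PPWithin φ) (dnf φ)
  dnf-PPWithin (atom R xs) = ppWithin (atom R xs) ⊆-refl ≤-refl ∷ []
  dnf-PPWithin ⊤f = ppWithin ⊤f ⊆-refl ≤-refl ∷ []
  dnf-PPWithin (_∧f_ {φ} {ψ} φ-ep ψ-ep) =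
    All-cartesianProductWith (λ π π′ → PPWithin-∧ (weakenˡ π) (weakenʳ π′))
      (dnf-PPWithin φ-ep) (dnf-PPWithin ψ-ep)
    where
    weakenˡ : ∀ {π} → PPWithin φ π → PPWithin (φ ∧f ψ) π
    weakenˡ = PPWithin-weaken (xs⊆xs++ys _ _) (≤-trans (m≤n⊔m _ _) (m≤m⊔n _ (widthFO ψ)))
    weakenʳ : ∀ {π} → PPWithin ψ π → PPWithin (φ ∧f ψ) π
    weakenʳ = PPWithin-weaken (xs⊆ys++xs _ _) (m≤n⊔m _ _)
  dnf-PPWithin (_∨f_ {φ} {ψ} φ-ep ψ-ep) =
    All-++⁺ (All.map weakenˡ (dnf-PPWithin φ-ep)) (All.map weakenʳ (dnf-PPWithin ψ-ep))
    where
    weakenˡ : ∀ {π} → PPWithin φ π → PPWithin (φ ∨f ψ) π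
    weakenˡ = PPWithin-weaken (xs⊆xs++ys _ _) (≤-trans (m≤n⊔m _ _) (m≤m⊔n _ (widthFO ψ)))
    weakenʳ : ∀ {π} → PPWithin ψ π → PPWithin (φ ∨f ψ) π
    weakenʳ = PPWithin-weaken (xs⊆ys++xs _ _) (m≤n⊔m _ _)
  dnf-PPWithin (∃f x φ-ep) = gmap⁺ (PPWithin-∃ x) (dnf-PPWithin φ-ep)

  width-free : (φ : SF σ) → card (free φ) ≤ width φ
  width-free (C φ L) = m≤m⊔n _ _
  width-free (P V φ) = m≤m⊔n _ _
  width-free (E V φ) = m≤m⊔n _ _
  width-free (φ ⊗ ψ) = ≤-trans (m≤m⊔n _ (width φ)) (m≤m⊔n _ (width ψ))
  width-free (φ ⊕ ψ) = ≤-trans (m≤m⊔n _ (width φ)) (m≤m⊔n _ (width ψ))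
  width-free (const n) = ≤-refl

  Basic⇒SharpPP : ∀ {β : SF σ} → Basic β → SharpPP β
  Basic⇒SharpPP (C L pp) = C L pp
  Basic⇒SharpPP (P V β) = P V (Basic⇒SharpPP β)
  Basic⇒SharpPP (E V β) = E V (Basic⇒SharpPP β)
  Basic⇒SharpPP (β ⊗ γ) = Basic⇒SharpPP β ⊗ Basic⇒SharpPP γ

  record BasicWithin (φ β : SF σ) : Set where
    constructor basicWithin
    field
      basic   : Basic β
      wf      : WF β
      free≈   : free β ≈ˢ free φ
      closed⊆ : closed β ⊆ closed φ
      width≤  : width β ≤ width φ

  BasicWithin-C : ∀ {φ π L} → freeFO φ ⊆ L → PPWithin φ π → BasicWithin (C φ L) (C π L)
  BasicWithin-C φ⊆L (ppWithin pp free⊆ width≤) =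
    basicWithin (C _ pp) (C _ _ (⊆-trans free⊆ φ⊆L)) ≈ˢ-refl (λ ()) (⊔-monoʳ-≤ _ width≤)

  BasicWithin-P : ∀ {ψ β} V → Disjoint V (closed ψ) → BasicWithin ψ β → BasicWithin (P V ψ) (P V β)
  BasicWithin-P V V#ψ (basicWithin basic wf free≈ closed⊆ width≤) =
    basicWithin (P V basic) (P V wf (λ x∈V x∈β → V#ψ x∈V (closed⊆ x∈β))) (removeAll-≈ˢ V free≈)
      (++⁺ʳ V closed⊆) (⊔-mono-≤ (card-mono (removeAll⁺ V (proj₁ free≈))) width≤)

  BasicWithin-E : ∀ {ψ β} V → Disjoint V (free ψ) → Disjoint V (closed ψ) →
    BasicWithin ψ β → BasicWithin (E V ψ) (E V β)
  BasicWithin-E V V#freeψ V#closedψ (basicWithin basic wf free≈ closed⊆ width≤) =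
    basicWithin (E V basic)
      (E V wf (λ x∈V x∈β → V#freeψ x∈V (proj₁ free≈ x∈β)) (λ x∈V x∈β → V#closedψ x∈V (closed⊆ x∈β)))
      (++⁺ʳ V (proj₁ free≈) , ++⁺ʳ V (proj₂ free≈)) closed⊆
      (⊔-mono-≤ (card-mono (++⁺ʳ V (proj₁ free≈))) width≤)

  BasicWithin-⊗ : ∀ {ψ χ β γ} → free ψ ≈ˢ free χ → Disjoint (closed ψ) (closed χ) →
    BasicWithin ψ β → BasicWithin χ γ → BasicWithin (ψ ⊗ χ) (β ⊗ γ)
  BasicWithin-⊗ ψ≈χ ψ#χ (basicWithin basic wf free≈ closed⊆ width≤)
                        (basicWithin basic′ wf′ free≈′ closed⊆′ width≤′) =
    basicWithin (basic ⊗ basic′)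
      ((wf ⊗ wf′) (≈ˢ-trans free≈ (≈ˢ-trans ψ≈χ (≈ˢ-sym free≈′))) (λ x∈β x∈γ → ψ#χ (closed⊆ x∈β) (closed⊆′ x∈γ)))
      free≈ (++⁺ closed⊆ closed⊆′) (⊔-mono-≤ (⊔-mono-≤ (card-mono (proj₁ free≈)) width≤) width≤′)

  BasicWithin-⊕ˡ : ∀ {ψ χ β} → BasicWithin ψ β → BasicWithin (ψ ⊕ χ) β
  BasicWithin-⊕ˡ {ψ} {χ} (basicWithin basic wf free≈ closed⊆ width≤) =
    basicWithin basic wf free≈ (⊆-trans closed⊆ (xs⊆xs++ys _ _))
      (≤-trans width≤ (≤-trans (m≤n⊔m (card (free ψ)) _) (m≤m⊔n _ (width χ))))

  BasicWithin-⊕ʳ : ∀ {ψ χ γ} → free ψ ≈ˢ free χ → BasicWithin χ γ → BasicWithin (ψ ⊕ χ) γ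
  BasicWithin-⊕ʳ ψ≈χ (basicWithin basic wf free≈ closed⊆ width≤) =
    basicWithin basic wf (≈ˢ-trans free≈ (≈ˢ-sym ψ≈χ)) (⊆-trans closed⊆ (xs⊆ys++xs _ _))
      (≤-trans width≤ (m≤n⊔m _ _))

  BasicWithin-const : ∀ n → BasicWithin (const n) (C ⊤f [])
  BasicWithin-const n = basicWithin (C [] ⊤f) (C ⊤f [] (λ ())) ≈ˢ-refl (λ ()) z≤n

  linearForm : SF σ → LinComb (SF σ)
  linearForm (C φ L) = map (map₂ (λ π → C π L)) (inclusionExclusion _∧f_ (dnf φ))
  linearForm (P V ψ) = map (map₂ (P V)) (linearForm ψ)
  linearForm (E V ψ) = map (map₂ (E V)) (linearForm ψ)
  linearForm (ψ ⊗ χ) = mulLC _⊗_ (linearForm ψ) (linearForm χ)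
  linearForm (ψ ⊕ χ) = linearForm ψ ++ linearForm χ
  linearForm (const n) = [ n , C ⊤f [] ]

  ⟦_⟧ᴸ : LinComb (SF σ) → (𝔹 : Structure σ) → Assign 𝔹 → ℤ
  ⟦ ts ⟧ᴸ 𝔹 g = evalLC (λ β → ⟦ β ⟧ 𝔹 g) ts

  linearForm-sound : ∀ {φ} → SharpEP φ → (𝔹 : Structure σ) (g : Assign 𝔹) → ⟦ φ ⟧ 𝔹 g ≡ ⟦ linearForm φ ⟧ᴸ 𝔹 g
  linearForm-sound (C {φ} L ep) 𝔹 g = begin
    ind (evalFO 𝔹 φ g)
      ≡⟨ cong ind (evalFO-dnf ep 𝔹 g) ⟩
    ind (any (λ π → evalFO 𝔹 π g) (dnf φ))
      ≡⟨ evalLC-inclusionExclusion (λ π → evalFO 𝔹 π g) _∧f_ (λ _ _ → refl) (dnf φ) ⟨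
    evalLC (λ π → ind (evalFO 𝔹 π g)) (inclusionExclusion _∧f_ (dnf φ))
      ≡⟨ evalLC-map₂ (λ β → ⟦ β ⟧ 𝔹 g) (λ π → C π L) (inclusionExclusion _∧f_ (dnf φ)) ⟨
    ⟦ linearForm (C φ L) ⟧ᴸ 𝔹 g
      ∎
    where open ≡-Reasoning
  linearForm-sound (P V {ψ} ψ-ep) 𝔹 g = begin
    sumOver 𝔹 W g (⟦ ψ ⟧ 𝔹)
      ≡⟨ sumOver-cong 𝔹 W g (linearForm-sound ψ-ep 𝔹) ⟩
    sumOver 𝔹 W g (⟦ linearForm ψ ⟧ᴸ 𝔹)
      ≡⟨ sumOver-evalLC 𝔹 W g (λ β → ⟦ β ⟧ 𝔹) (linearForm ψ) ⟩
    evalLC (λ β → sumOver 𝔹 W g (⟦ β ⟧ 𝔹)) (linearForm ψ)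
      ≡⟨ evalLC-map₂ (λ β → ⟦ β ⟧ 𝔹 g) (P V) (linearForm ψ) ⟨
    ⟦ linearForm (P V ψ) ⟧ᴸ 𝔹 g
      ∎
    where
    open ≡-Reasoning
    W = deduplicate _≟_ V
  linearForm-sound (E V {ψ} ψ-ep) 𝔹 g =
    trans (linearForm-sound ψ-ep 𝔹 g) (sym (evalLC-map₂ (λ β → ⟦ β ⟧ 𝔹 g) (E V) (linearForm ψ)))
  linearForm-sound (_⊗_ {ψ} {χ} ψ-ep χ-ep) 𝔹 g =
    trans (cong₂ _*ℤ_ (linearForm-sound ψ-ep 𝔹 g) (linearForm-sound χ-ep 𝔹 g))
          (sym (evalLC-mulLC (λ β → ⟦ β ⟧ 𝔹 g) _⊗_ (λ _ _ → refl) (linearForm ψ) (linearForm χ)))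
  linearForm-sound (_⊕_ {ψ} {χ} ψ-ep χ-ep) 𝔹 g =
    trans (cong₂ _+ℤ_ (linearForm-sound ψ-ep 𝔹 g) (linearForm-sound χ-ep 𝔹 g))
          (sym (evalLC-++ (λ β → ⟦ β ⟧ 𝔹 g) (linearForm ψ) (linearForm χ)))
  linearForm-sound (const n) 𝔹 g = sym (trans (+-identityʳ _) (*-identityʳ n))

  linearForm-BasicWithin : ∀ {φ} → WF φ → SharpEP φ → All (BasicWithin φ ∘ proj₂) (linearForm φ)
  linearForm-BasicWithin (C φ L φ⊆L) (C .L ep) =
    gmap⁺ (BasicWithin-C φ⊆L) (All-inclusionExclusion PPWithin-∧ (dnf-PPWithin ep))
  linearForm-BasicWithin (P V ψ-wf V#ψ) (P .V ψ-ep) =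
    gmap⁺ (BasicWithin-P V V#ψ) (linearForm-BasicWithin ψ-wf ψ-ep)
  linearForm-BasicWithin (E V ψ-wf V#freeψ V#closedψ) (E .V ψ-ep) =
    gmap⁺ (BasicWithin-E V V#freeψ V#closedψ) (linearForm-BasicWithin ψ-wf ψ-ep)
  linearForm-BasicWithin ((ψ-wf ⊗ χ-wf) ψ≈χ ψ#χ) (ψ-ep ⊗ χ-ep) =
    All-mulLC (BasicWithin-⊗ ψ≈χ ψ#χ) (linearForm-BasicWithin ψ-wf ψ-ep) (linearForm-BasicWithin χ-wf χ-ep)
  linearForm-BasicWithin ((ψ-wf ⊕ χ-wf) ψ≈χ) (ψ-ep ⊕ χ-ep) =
    All-++⁺ (All.map BasicWithin-⊕ˡ (linearForm-BasicWithin ψ-wf ψ-ep))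
            (All.map (BasicWithin-⊕ʳ ψ≈χ) (linearForm-BasicWithin χ-wf χ-ep))
  linearForm-BasicWithin (const n) (const .n) = BasicWithin-const n ∷ []

  -- A coefficient c becomes E F (c), so that both factors of c × β have free variables F;
  -- Flat demands a nonempty sum, so the empty combination becomes 0 × C(⊤, F).
  flatSum : List Var → LinComb (SF σ) → SF σ
  flatSum F [] = E F (const 0ℤ) ⊗ C ⊤f F
  flatSum F ((c , β) ∷ ts) = (E F (const c) ⊗ β) ⊕ flatSum F ts

  flatSum-free : ∀ F ts → free (flatSum F ts) ≈ˢ F
  flatSum-free F [] = xs++[]≈ˢxs F
  flatSum-free F (t ∷ ts) = xs++[]≈ˢxs F

  flatSum-sound : ∀ F ts (𝔹 : Structure σ) (g : Assign 𝔹) → ⟦ flatSum F ts ⟧ 𝔹 g ≡ ⟦ ts ⟧ᴸ 𝔹 g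
  flatSum-sound F [] 𝔹 g = refl
  flatSum-sound F ((c , β) ∷ ts) 𝔹 g = cong (c *ℤ ⟦ β ⟧ 𝔹 g +ℤ_) (flatSum-sound F ts 𝔹 g)

  flatSum-Flat : ∀ {φ} ts → All (BasicWithin φ ∘ proj₂) ts → Flat (flatSum (free φ) ts)
  flatSum-Flat [] [] = term (E _ (const 0ℤ)) (C _ ⊤f)
  flatSum-Flat ((c , β) ∷ ts) (β-within ∷ ts-within) =
    term (E _ (const c)) (BasicWithin.basic β-within) ⊕ flatSum-Flat ts ts-within

  flatSum-SharpPP : ∀ {φ} ts → All (BasicWithin φ ∘ proj₂) ts → SharpPP (flatSum (free φ) ts)
  flatSum-SharpPP [] [] = E _ (const 0ℤ) ⊗ C _ ⊤f
  flatSum-SharpPP ((c , β) ∷ ts) (β-within ∷ ts-within) =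
    (E _ (const c) ⊗ Basic⇒SharpPP (BasicWithin.basic β-within)) ⊕ flatSum-SharpPP ts ts-within

  module _ (φ : SF σ) where

    private
      F = free φ

      E-const-WF : ∀ c → WF (E F (const {σ} c))
      E-const-WF c = E F (const c) (λ _ ()) (λ _ ())

      card-F++[] : card (F ++ []) ≤ width φ
      card-F++[] = ≤-trans (card-mono (proj₁ (xs++[]≈ˢxs F))) (width-free φ)

      width-E-const : ∀ c → width (E F (const {σ} c)) ≤ width φ
      width-E-const c = ⊔-lub card-F++[] z≤n

    flatSum-WF : ∀ ts → All (BasicWithin φ ∘ proj₂) ts → WF (flatSum F ts)
    flatSum-WF [] [] = (E-const-WF 0ℤ ⊗ C ⊤f F (λ ())) (xs++[]≈ˢxs F) (λ ())
    flatSum-WF ((c , β) ∷ ts) (basicWithin _ β-wf β-free≈ _ _ ∷ ts-within) =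
      ((E-const-WF c ⊗ β-wf) (≈ˢ-trans (xs++[]≈ˢxs F) (≈ˢ-sym β-free≈)) (λ ()) ⊕ flatSum-WF ts ts-within)
        (≈ˢ-trans (xs++[]≈ˢxs F) (≈ˢ-sym (flatSum-free F ts)))

    flatSum-width : ∀ ts → All (BasicWithin φ ∘ proj₂) ts → width (flatSum F ts) ≤ width φ
    flatSum-width [] [] = ⊔-lub (⊔-lub card-F++[] (width-E-const 0ℤ)) (⊔-lub (width-free φ) z≤n)
    flatSum-width ((c , β) ∷ ts) (β-within ∷ ts-within) =
      ⊔-lub (⊔-lub card-F++[] (⊔-lub (⊔-lub card-F++[] (width-E-const c)) (BasicWithin.width≤ β-within)))
            (flatSum-width ts ts-within)

lemmaC1 : (σ : Signature) →
    Σ[ alg ∈ (SF σ → SF σ) ]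
      (∀ (φ : SF σ) → WF φ → SharpEP φ →
        WF (alg φ) × SharpPP (alg φ) × Flat (alg φ) ×
        LogEquiv φ (alg φ) × (width (alg φ) ≤ width φ))
lemmaC1 σ = flatten , λ φ φ-wf φ-ep →
  let within = linearForm-BasicWithin φ-wf φ-ep in
  flatSum-WF φ (linearForm φ) within ,
  flatSum-SharpPP (linearForm φ) within ,
  flatSum-Flat (linearForm φ) within ,
  (≈ˢ-sym (flatSum-free (free φ) (linearForm φ)) ,
   λ 𝔹 g → trans (linearForm-sound φ-ep 𝔹 g) (sym (flatSum-sound (free φ) (linearForm φ) 𝔹 g))) ,
  flatSum-width φ (linearForm φ) within
  where
  flatten : SF σ → SF σ
  flatten φ = flatSum (free φ) (linearForm φ)
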